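{- Let $Y_1,Y_2,\ldots$ be i.i.d. Bernoulli$(1/2)$ and $(Z^k)_{k\ge2}$ generated by the bit-drop scheme, independently of $Y$ (see context), and let $L^a_n(k)$ be the length of the longest common subsequence of $Z^k$ and $Y_1\ldots Y_n$. There exists a constant $c>0$ such that for every $n$ and every $\nu<0.5$, $$P\big(L^a_n(\nu n)=\nu n\big)\geq1-e^{ -c(0.5-\nu)^2n}.$$
   Context: Bit-drop scheme: $V_1,V_2,\ldots$ i.i.d. Bernoulli$(1/2)$; $T_3,T_4,\ldots$ independent, independent of $\{V_k\}$, $T_{k+1}$ uniform on $\{2,\ldots,k\}$; $Z^2:=V_1V_2$ and $Z^{k+1}$ is obtained from $Z^k=Z^k_1\ldots Z^k_k$ by inserting $V_{k+1}$ at position $T_{k+1}$ ($Z^{k+1}_j=Z^k_j$ for $j<T_{k+1}$, $Z^{k+1}_{T_{k+1}}=V_{k+1}$, $Z^{k+1}_j=Z^k_{j-1}$ for $j>T_{k+1}$). -}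

module Defs where

open import Data.Bool using (Bool; true; false; if_then_else_)
open import Data.Bool.Properties using () renaming (_≟_ to _≟B_)
open import Data.Nat as ℕ using (ℕ; zero; suc; _∸_)
open import Data.List using (List; []; _∷_; _++_; map; concatMap; take; drop; length; foldr; sum)
open import Data.List.Relation.Binary.Sublist.DecPropositional _≟B_ using (_⊆?_)
open import Data.Integer using (+_)
open import Data.Rational using (ℚ; _/_; _+_; _*_; 0ℚ; 1ℚ)
open import Relation.Nullary using (does)
open import Data.Product using (_×_; _,_) public

subseqs : {A : Set} → List A → List (List A)
subseqs []       = [] ∷ []
subseqs (x ∷ xs) = let r = subseqs xs in map (x ∷_) r ++ r

LCS : List Bool → List Bool → ℕ
LCS xs ys = foldr ℕ._⊔_ 0
  (map length (Data.List.filter (λ s → s ⊆? ys) (subseqs xs)))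
  where import Data.List

-- insertAt p x xs : insert x so that it sits at (1-indexed) position p
insertAt : {A : Set} → ℕ → A → List A → List A
insertAt p x xs = take (p ∸ 1) xs ++ x ∷ drop (p ∸ 1) xs

insertAll : List (Bool × ℕ) → List Bool → List Bool
insertAll []             z = z
insertAll ((v , t) ∷ vt) z = insertAll vt (insertAt t v z)

-- (sample space for Z^k, k ≥ 2)
-- An outcome: bits V_1,V_2 and the list of pairs (V_j , T_j), j = 3..k.
-- Z^k = insertAll [(V_3,T_3),…,(V_k,T_k)] (V_1 V_2)

bitStrings : ℕ → List (List Bool)
bitStrings zero    = [] ∷ []
bitStrings (suc m) = concatMap (λ s → (true ∷ s) ∷ (false ∷ s) ∷ []) (bitStrings m)

-- the values {2,…,j-1} (the support of T_j)
range2 : ℕ → List ℕ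
range2 j = map (λ i → 2 ℕ.+ i) (Data.List.upTo (j ∸ 2))
  where import Data.List

-- all sequences ((V_3,T_3),…,(V_k,T_k)) with T_j ∈ {2,…,j-1}:
-- insSeqs k j enumerates the pairs for indices j,…,k
insSeqsFrom : (fuel j k : ℕ) → List (List (Bool × ℕ))
insSeqsFrom zero       j k = [] ∷ []
insSeqsFrom (suc fuel) j k =
  concatMap (λ rest →
    concatMap (λ v → map (λ t → (v , t) ∷ rest) (range2 j)) (true ∷ false ∷ []))
    (insSeqsFrom fuel (suc j) k)

insSeqs : ℕ → List (List (Bool × ℕ))
insSeqs k = insSeqsFrom (k ∸ 2) 3 k

-- all equally likely outcomes (V_1,V_2,(V_j,T_j)_{3≤j≤k}) together with
-- the resulting Z^k
bitDropOutcomes : ℕ → List (List Bool)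
bitDropOutcomes k =
  concatMap (λ v12 → map (λ ins → insertAll ins v12) (insSeqs k)) (bitStrings 2)

-- Finite uniform probability: the proportion of equally likely
-- outcomes at which a Boolean event holds.

average : List ℚ → ℚ
average []       = 0ℚ
average (x ∷ xs) = foldr _+_ 0ℚ (x ∷ xs) * ((+ 1) / suc (length xs))

Prob : {Ω : Set} → List Ω → (Ω → Bool) → ℚ
Prob outcomes E = average (map (λ ω → if E ω then 1ℚ else 0ℚ) outcomes)

-- P( L^a_n(k) = k ),  L^a_n(k) = LCS (Z^k) (Y_1 … Y_n),
-- Z^k from the bit-drop scheme, Y i.i.d. fair bits independent of Z
probLCSfull : (n k : ℕ) → ℚ
probLCSfull n k =
  Prob (concatMap (λ z → map (λ y → z , y) (bitStrings n)) (bitDropOutcomes k))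
       (λ { (z , y) → does (LCS z y ℕ.≟ k) })

_^ℚ_ : ℚ → ℕ → ℚ
q ^ℚ zero  = 1ℚ
q ^ℚ suc m = q * (q ^ℚ m)

{-# OPTIONS --safe #-}
-- Every bit-drop outcome Z^k has length k, so L^a_n(k) = k as soon as Z^k is a subsequence of Y,
-- and for a fixed z of length k at most Σ_{i<k} C(n,i) strings y of length n avoid z. Hence the
-- failure probability is at most the binomial tail 2⁻ⁿ Σ_{i<k} C(n,i). With m = n − 2k and
-- q = ⌊n/m⌋, the Chernoff bound at ratio q/(q+1), together with Bernoulli's inequality in both
-- directions, gives (2⁻ⁿ Σ_{i<k} C(n,i))^{4n} ≤ (7/8)^{m²}; this is proved in ℕ after clearing
-- denominators and then cast to ℚ.
module Submission where

open import Defs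

module BinomialTail where

  open import Data.Nat
  open import Data.Nat.Properties
  open import Data.Nat.DivMod using (_/_; _%_; m/n*n≤m; m≡m%n+[m/n]*n; m%n<n; m≥n⇒m/n>0)
  open import Data.Nat.Tactic.RingSolver using (solve-∀)
  open import Algebra.Properties.CommutativeSemigroup *-commutativeSemigroup
    using (interchange; x∙yz≈xz∙y; x∙yz≈yx∙z; x∙yz≈y∙xz; xy∙z≈xz∙y; xy∙z≈y∙xz; xy∙z≈x∙zy)
  open import Relation.Binary.PropositionalEquality

  -- Σ_{i<k} C(n,i), by Pascal's rule.
  binomialTail : ℕ → ℕ → ℕ
  binomialTail n       zero    = 0
  binomialTail zero    (suc k) = 1
  binomialTail (suc n) (suc k) = binomialTail n k + binomialTail n (suc k)

  ^-distribʳ-* : ∀ x y e → (x * y) ^ e ≡ x ^ e * y ^ e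
  ^-distribʳ-* x y zero    = refl
  ^-distribʳ-* x y (suc e) = begin
    x * y * (x * y) ^ e     ≡⟨ cong (x * y *_) (^-distribʳ-* x y e) ⟩
    x * y * (x ^ e * y ^ e) ≡⟨ interchange x y (x ^ e) (y ^ e) ⟩
    x * x ^ e * (y * y ^ e) ∎
    where open ≡-Reasoning

  [x^a*y^b]^c : ∀ x y a b c → (x ^ a * y ^ b) ^ c ≡ x ^ (a * c) * y ^ (b * c)
  [x^a*y^b]^c x y a b c = trans (^-distribʳ-* (x ^ a) (y ^ b) c) (cong₂ _*_ (^-*-assoc x a c) (^-*-assoc y b c))

  x^[2k+m] : ∀ x k m → x ^ (2 * k + m) ≡ (x * x) ^ k * x ^ m
  x^[2k+m] x k m = begin
    x ^ (2 * k + m)     ≡⟨ ^-distribˡ-+-* x (2 * k) m ⟩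
    x ^ (2 * k) * x ^ m ≡⟨ cong (_* x ^ m) (^-*-assoc x 2 k) ⟨
    (x ^ 2) ^ k * x ^ m ≡⟨ cong (λ y → (x * y) ^ k * x ^ m) (*-identityʳ x) ⟩
    (x * x) ^ k * x ^ m ∎
    where open ≡-Reasoning

  ^-monoˡ-≤-* : ∀ {a b c d} e → a * b ≤ c * d → a ^ e * b ^ e ≤ c ^ e * d ^ e
  ^-monoˡ-≤-* {a} {b} {c} {d} e ab≤cd = begin
    a ^ e * b ^ e ≡⟨ ^-distribʳ-* a b e ⟨
    (a * b) ^ e   ≤⟨ ^-monoˡ-≤ e ab≤cd ⟩
    (c * d) ^ e   ≡⟨ ^-distribʳ-* c d e ⟩
    c ^ e * d ^ e ∎
    where open ≤-Reasoning

  [b/a]^e≤[b/a]^f : ∀ {a b e f} → a ≤ b → e ≤ f → b ^ e * a ^ f ≤ b ^ f * a ^ e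
  [b/a]^e≤[b/a]^f {a} {b} {e} {f} a≤b e≤f = begin
    b ^ e * a ^ f             ≡⟨ cong (λ g → b ^ e * a ^ g) f≡e+d ⟩
    b ^ e * a ^ (e + d)       ≡⟨ cong (b ^ e *_) (^-distribˡ-+-* a e d) ⟩
    b ^ e * (a ^ e * a ^ d)   ≤⟨ *-monoʳ-≤ (b ^ e) (*-monoʳ-≤ (a ^ e) (^-monoˡ-≤ d a≤b)) ⟩
    b ^ e * (a ^ e * b ^ d)   ≡⟨ x∙yz≈xz∙y (b ^ e) (a ^ e) (b ^ d) ⟩
    b ^ e * b ^ d * a ^ e     ≡⟨ cong (_* a ^ e) (^-distribˡ-+-* b e d) ⟨
    b ^ (e + d) * a ^ e       ≡⟨ cong (λ g → b ^ g * a ^ e) f≡e+d ⟨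
    b ^ f * a ^ e             ∎
    where
    open ≤-Reasoning
    d = f ∸ e
    f≡e+d : f ≡ e + d
    f≡e+d = sym (m+[n∸m]≡n e≤f)

  cross-≤-trans : ∀ {a c d s q} p .{{_ : NonZero p}} → a * p ≤ s * q → q * c ≤ d * p → a * c ≤ d * s
  cross-≤-trans {a} {c} {d} {s} {q} p ap≤sq qc≤dp = *-cancelʳ-≤ (a * c) (d * s) p (begin
    a * c * p   ≡⟨ xy∙z≈xz∙y a c p ⟩
    a * p * c   ≤⟨ *-monoˡ-≤ c ap≤sq ⟩
    s * q * c   ≡⟨ *-assoc s q c ⟩
    s * (q * c) ≤⟨ *-monoʳ-≤ s qc≤dp ⟩
    s * (d * p) ≡⟨ x∙yz≈yx∙z s d p ⟩
    d * s * p   ∎)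
    where open ≤-Reasoning

  binomialTail-chernoff : ∀ {a b} → a ≤ b → ∀ n k → binomialTail n k * a ^ k * b ^ n ≤ b ^ k * (a + b) ^ n
  binomialTail-chernoff a≤b n       zero    = z≤n
  binomialTail-chernoff a≤b zero    (suc k) =
    *-monoˡ-≤ 1 (≤-trans (≤-reflexive (+-identityʳ _)) (^-monoˡ-≤ (suc k) a≤b))
  binomialTail-chernoff {a} {b} a≤b (suc n) (suc k) = begin
    (t + t′) * (a * a ^ k) * (b * b ^ n)
      ≡⟨ split t t′ a b (a ^ k) (b ^ n) ⟩
    t * a ^ k * b ^ n * (a * b) + t′ * (a * a ^ k) * b ^ n * b
      ≤⟨ +-mono-≤ (*-monoˡ-≤ (a * b) (binomialTail-chernoff a≤b n k))
                  (*-monoˡ-≤ b (binomialTail-chernoff a≤b n (suc k))) ⟩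
    b ^ k * (a + b) ^ n * (a * b) + b * b ^ k * (a + b) ^ n * b
      ≡⟨ merge a b (b ^ k) ((a + b) ^ n) ⟩
    b * b ^ k * ((a + b) * (a + b) ^ n) ∎
    where
    open ≤-Reasoning
    t = binomialTail n k
    t′ = binomialTail n (suc k)
    split : ∀ t t′ a b x y → (t + t′) * (a * x) * (b * y) ≡ t * x * y * (a * b) + t′ * (a * x) * y * b
    split = solve-∀
    merge : ∀ a b x y → x * y * (a * b) + b * x * y * b ≡ b * x * ((a + b) * y)
    merge = solve-∀

  [1+1/x]^n≥1+n/x : ∀ x n → x ^ n * (x + n) ≤ suc x ^ n * x
  [1+1/x]^n≥1+n/x x zero    = ≤-reflexive (+-identityʳ (x + 0))
  [1+1/x]^n≥1+n/x x (suc n) = begin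
    x * x ^ n * (x + suc n)             ≤⟨ m≤m+n _ (x ^ n * n) ⟩
    x * x ^ n * (x + suc n) + x ^ n * n ≡⟨ expand x (x ^ n) n ⟩
    suc x * (x ^ n * (x + n))           ≤⟨ *-monoʳ-≤ (suc x) ([1+1/x]^n≥1+n/x x n) ⟩
    suc x * (suc x ^ n * x)             ≡⟨ *-assoc (suc x) (suc x ^ n) x ⟨
    suc x * suc x ^ n * x               ∎
    where
    open ≤-Reasoning
    expand : ∀ x y n → x * y * (x + suc n) + y * n ≡ suc x * (y * (x + n))
    expand = solve-∀

  [1-1/[1+x]]^n≥1-n/[1+x] : ∀ x n → suc x ^ n * suc x ≤ x ^ n * suc x + n * suc x ^ n
  [1-1/[1+x]]^n≥1-n/[1+x] x zero    = m≤m+n _ 0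
  [1-1/[1+x]]^n≥1-n/[1+x] x (suc n) = begin
    suc x * suc x ^ n * suc x
      ≡⟨ *-assoc (suc x) (suc x ^ n) (suc x) ⟩
    suc x * (suc x ^ n * suc x)
      ≤⟨ *-monoʳ-≤ (suc x) ([1-1/[1+x]]^n≥1-n/[1+x] x n) ⟩
    suc x * (x ^ n * suc x + n * suc x ^ n)
      ≡⟨ expand x (x ^ n) (suc x ^ n) n ⟩
    x * x ^ n * suc x + x ^ n * suc x + n * (suc x * suc x ^ n)
      ≤⟨ +-monoˡ-≤ (n * (suc x * suc x ^ n))
           (+-monoʳ-≤ (x * x ^ n * suc x) (*-monoˡ-≤ (suc x) (^-monoˡ-≤ n (n≤1+n x)))) ⟩
    x * x ^ n * suc x + suc x ^ n * suc x + n * (suc x * suc x ^ n)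
      ≡⟨ collect x (x ^ n) (suc x ^ n) n ⟩
    x * x ^ n * suc x + suc n * (suc x * suc x ^ n) ∎
    where
    open ≤-Reasoning
    expand : ∀ x y z n → suc x * (y * suc x + n * z) ≡ x * y * suc x + y * suc x + n * (suc x * z)
    expand = solve-∀
    collect : ∀ x y z n → x * y * suc x + z * suc x + n * (suc x * z) ≡ x * y * suc x + suc n * (suc x * z)
    collect = solve-∀

  [1+1/x]^n≤2 : ∀ x n → 2 * n ≤ suc x → suc x ^ n ≤ 2 * x ^ n
  [1+1/x]^n≤2 x n 2n≤1+x = *-cancelʳ-≤ _ _ (suc x) (+-cancelʳ-≤ y _ _ (begin
    suc x ^ n * suc x + y                 ≡⟨ double (suc x) (suc x ^ n) ⟩
    2 * (suc x ^ n * suc x)               ≤⟨ *-monoʳ-≤ 2 ([1-1/[1+x]]^n≥1-n/[1+x] x n) ⟩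
    2 * (x ^ n * suc x + n * suc x ^ n)   ≡⟨ distrib (suc x) (x ^ n) (suc x ^ n) n ⟩
    2 * x ^ n * suc x + 2 * n * suc x ^ n ≤⟨ +-monoʳ-≤ _ (*-monoˡ-≤ (suc x ^ n) 2n≤1+x) ⟩
    2 * x ^ n * suc x + y                 ∎))
    where
    open ≤-Reasoning
    y = suc x * suc x ^ n
    double : ∀ a z → z * a + a * z ≡ 2 * (z * a)
    double = solve-∀
    distrib : ∀ a z w n → 2 * (z * a + n * w) ≡ 2 * z * a + 2 * n * w
    distrib = solve-∀

  [1+1/x]^e≤2^t : ∀ x .{{_ : NonZero x}} {K e t} → 2 * K ≤ suc x → e ≤ K * t → suc x ^ e ≤ 2 ^ t * x ^ e
  [1+1/x]^e≤2^t x {K} {e} {t} 2K≤1+x e≤Kt = *-cancelʳ-≤ _ _ (x ^ f) {{m^n≢0 x f}} (begin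
    suc x ^ e * x ^ f           ≤⟨ [b/a]^e≤[b/a]^f (n≤1+n x) e≤Kt ⟩
    suc x ^ f * x ^ e           ≡⟨ cong (_* x ^ e) (^-*-assoc (suc x) K t) ⟨
    (suc x ^ K) ^ t * x ^ e     ≤⟨ *-monoˡ-≤ (x ^ e) (^-monoˡ-≤ t ([1+1/x]^n≤2 x K 2K≤1+x)) ⟩
    (2 * x ^ K) ^ t * x ^ e     ≡⟨ cong (_* x ^ e) (^-distribʳ-* 2 (x ^ K) t) ⟩
    2 ^ t * (x ^ K) ^ t * x ^ e ≡⟨ cong (λ y → 2 ^ t * y * x ^ e) (^-*-assoc x K t) ⟩
    2 ^ t * x ^ f * x ^ e       ≡⟨ xy∙z≈xz∙y (2 ^ t) (x ^ f) (x ^ e) ⟩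
    2 ^ t * x ^ e * x ^ f       ∎)
    where
    open ≤-Reasoning
    f = K * t

  16[2q+1]^4q≤7[2q+2]^4q : ∀ q .{{_ : NonZero q}} → 16 * suc (2 * q) ^ (4 * q) ≤ 7 * suc (suc (2 * q)) ^ (4 * q)
  16[2q+1]^4q≤7[2q+2]^4q q@(suc p) = *-cancelʳ-≤ _ _ α (begin
    16 * α ^ (4 * q) * α            ≡⟨ xy∙z≈y∙xz 16 (α ^ (4 * q)) α ⟩
    α ^ (4 * q) * (16 * α)          ≤⟨ *-monoʳ-≤ (α ^ (4 * q)) 16α≤7[α+4q] ⟩
    α ^ (4 * q) * (7 * (α + 4 * q)) ≡⟨ x∙yz≈y∙xz (α ^ (4 * q)) 7 (α + 4 * q) ⟩
    7 * (α ^ (4 * q) * (α + 4 * q)) ≤⟨ *-monoʳ-≤ 7 ([1+1/x]^n≥1+n/x α (4 * q)) ⟩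
    7 * (suc α ^ (4 * q) * α)       ≡⟨ *-assoc 7 (suc α ^ (4 * q)) α ⟨
    7 * suc α ^ (4 * q) * α         ∎)
    where
    open ≤-Reasoning
    α = suc (2 * q)
    excess : ∀ p → 7 * (suc (2 * suc p) + 4 * suc p) ≡ 16 * suc (2 * suc p) + suc (10 * p)
    excess = solve-∀
    16α≤7[α+4q] : 16 * α ≤ 7 * (α + 4 * q)
    16α≤7[α+4q] = ≤-trans (m≤m+n (16 * α) (suc (10 * p))) (≤-reflexive (sym (excess p)))

  binomialTail-split : ∀ u k m → let α = suc u; β = suc α; n = 2 * k + m in
    binomialTail n k * ((u * β) ^ k * β ^ m) ≤ 2 ^ n * ((α * α) ^ k * α ^ m)
  binomialTail-split u k m = *-cancelʳ-≤ _ _ (β ^ k) {{m^n≢0 β k}} (begin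
    t * ((u * β) ^ k * β ^ m) * β ^ k      ≡⟨ cong (λ y → t * (y * β ^ m) * β ^ k) (^-distribʳ-* u β k) ⟩
    t * (u ^ k * β ^ k * β ^ m) * β ^ k    ≡⟨ regroup t (u ^ k) (β ^ k) (β ^ m) ⟩
    t * u ^ k * (β ^ k * β ^ k * β ^ m)    ≡⟨ cong (λ y → t * u ^ k * (y * β ^ m)) (^-distribʳ-* β β k) ⟨
    t * u ^ k * ((β * β) ^ k * β ^ m)      ≡⟨ cong (t * u ^ k *_) (x^[2k+m] β k m) ⟨
    t * u ^ k * β ^ n                      ≤⟨ binomialTail-chernoff (≤-trans (n≤1+n u) (n≤1+n (suc u))) n k ⟩
    β ^ k * (u + β) ^ n                    ≡⟨ cong (λ y → β ^ k * y ^ n) (u+β≡2α u) ⟩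
    β ^ k * (2 * α) ^ n                    ≡⟨ cong (β ^ k *_) (^-distribʳ-* 2 α n) ⟩
    β ^ k * (2 ^ n * α ^ n)                ≡⟨ cong (λ y → β ^ k * (2 ^ n * y)) (x^[2k+m] α k m) ⟩
    β ^ k * (2 ^ n * ((α * α) ^ k * α ^ m)) ≡⟨ *-comm (β ^ k) _ ⟩
    2 ^ n * ((α * α) ^ k * α ^ m) * β ^ k  ∎)
    where
    open ≤-Reasoning
    α = suc u
    β = suc α
    n = 2 * k + m
    t = binomialTail n k
    regroup : ∀ t x y z → t * (x * y * z) * y ≡ t * x * (y * y * z)
    regroup = solve-∀
    u+β≡2α : ∀ u → u + suc (suc u) ≡ 2 * suc u
    u+β≡2α = solve-∀

  -- q stands for n / m, where n = 2k + m: binomialTail-split at u = 2q bounds 2⁻ⁿ · binomialTail n k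
  -- by ((N + 1) / N)ᵏ (α / β)ᵐ, and each factor is then estimated in terms of m² / 4n.
  module TailBound (q k m : ℕ) .{{_ : NonZero q}} (2k≤qm : 2 * k ≤ q * m) (qm≤n : q * m ≤ 2 * k + m) where

    private
      n = 2 * k + m
      u = 2 * q
      α = suc u
      β = suc α
      N = u * β
      M = m * m
      E = k * (4 * n)
      H = m * (4 * n)

      N≢0 : NonZero N
      N≢0 = m*n≢0 u β {{m*n≢0 2 q}}

    [1+1/N]^E≤2^M : (α * α) ^ E ≤ 2 ^ M * N ^ E
    [1+1/N]^E≤2^M = subst (λ y → y ^ E ≤ 2 ^ M * N ^ E) (sym (α*α≡1+N q))
      ([1+1/x]^e≤2^t N {{N≢0}} {K = 2 * q * suc q} 2K≤1+N E≤KM)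
      where
      α*α≡1+N : ∀ q → suc (2 * q) * suc (2 * q) ≡ suc (2 * q * suc (suc (2 * q)))
      α*α≡1+N = solve-∀
      2K≡N : ∀ q → 2 * (2 * q * suc q) ≡ 2 * q * suc (suc (2 * q))
      2K≡N = solve-∀
      2K≤1+N : 2 * (2 * q * suc q) ≤ suc N
      2K≤1+N = ≤-trans (≤-reflexive (2K≡N q)) (n≤1+n N)
      E≤KM : E ≤ 2 * q * suc q * M
      E≤KM = begin
        k * (4 * (2 * k + m))         ≡⟨ lhs k m ⟩
        2 * (2 * k * (2 * k + m))     ≤⟨ *-monoʳ-≤ 2 (*-mono-≤ 2k≤qm n≤[q+1]m) ⟩
        2 * (q * m * (suc q * m))     ≡⟨ rhs q m ⟩
        2 * q * suc q * (m * m)       ∎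
        where
        open ≤-Reasoning
        lhs : ∀ k m → k * (4 * (2 * k + m)) ≡ 2 * (2 * k * (2 * k + m))
        lhs = solve-∀
        rhs : ∀ q m → 2 * (q * m * (suc q * m)) ≡ 2 * q * suc q * (m * m)
        rhs = solve-∀
        n≤[q+1]m : 2 * k + m ≤ suc q * m
        n≤[q+1]m = ≤-trans (+-monoˡ-≤ m 2k≤qm) (≤-reflexive (+-comm (q * m) m))

    16^M*[α/β]^H≤7^M : 16 ^ M * α ^ H ≤ 7 ^ M * β ^ H
    16^M*[α/β]^H≤7^M = *-cancelʳ-≤ _ _ (β ^ G) {{m^n≢0 β G}} (begin
      16 ^ M * α ^ H * β ^ G   ≡⟨ xy∙z≈x∙zy (16 ^ M) (α ^ H) (β ^ G) ⟩
      16 ^ M * (β ^ G * α ^ H) ≤⟨ *-monoʳ-≤ (16 ^ M) ([b/a]^e≤[b/a]^f (n≤1+n α) G≤H) ⟩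
      16 ^ M * (β ^ H * α ^ G) ≡⟨ x∙yz≈xz∙y (16 ^ M) (β ^ H) (α ^ G) ⟩
      16 ^ M * α ^ G * β ^ H   ≤⟨ *-monoˡ-≤ (β ^ H) 16^M*[α/β]^G≤7^M ⟩
      7 ^ M * β ^ G * β ^ H    ≡⟨ xy∙z≈xz∙y (7 ^ M) (β ^ G) (β ^ H) ⟩
      7 ^ M * β ^ H * β ^ G    ∎)
      where
      open ≤-Reasoning
      G = 4 * q * M
      16^M*[α/β]^G≤7^M : 16 ^ M * α ^ G ≤ 7 ^ M * β ^ G
      16^M*[α/β]^G≤7^M = subst₂ (λ a b → 16 ^ M * a ≤ 7 ^ M * b) (^-*-assoc α (4 * q) M) (^-*-assoc β (4 * q) M)
        (^-monoˡ-≤-* M (16[2q+1]^4q≤7[2q+2]^4q q))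
      G≤H : G ≤ H
      G≤H = begin
        4 * q * (m * m)       ≡⟨ lhs q m ⟩
        4 * (q * m) * m       ≤⟨ *-monoˡ-≤ m (*-monoʳ-≤ 4 qm≤n) ⟩
        4 * (2 * k + m) * m   ≡⟨ *-comm (4 * n) m ⟩
        m * (4 * (2 * k + m)) ∎
        where
        lhs : ∀ q m → 4 * q * (m * m) ≡ 4 * (q * m) * m
        lhs = solve-∀

    chernoffRatio^4n≤[7/8]^M : ((α * α) ^ k * α ^ m) ^ (4 * n) * 8 ^ M ≤ 7 ^ M * (N ^ k * β ^ m) ^ (4 * n)
    chernoffRatio^4n≤[7/8]^M = *-cancelʳ-≤ _ _ (2 ^ M) {{m^n≢0 2 M}} (begin
      ((α * α) ^ k * α ^ m) ^ (4 * n) * 8 ^ M * 2 ^ M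
        ≡⟨ cong (λ y → y * 8 ^ M * 2 ^ M) ([x^a*y^b]^c (α * α) α k m (4 * n)) ⟩
      (α * α) ^ E * α ^ H * 8 ^ M * 2 ^ M
        ≡⟨ regroup ((α * α) ^ E) (α ^ H) (8 ^ M) (2 ^ M) ⟩
      (α * α) ^ E * ((8 ^ M * 2 ^ M) * α ^ H)
        ≡⟨ cong (λ y → (α * α) ^ E * (y * α ^ H)) (^-distribʳ-* 8 2 M) ⟨
      (α * α) ^ E * (16 ^ M * α ^ H)
        ≤⟨ *-mono-≤ [1+1/N]^E≤2^M 16^M*[α/β]^H≤7^M ⟩
      2 ^ M * N ^ E * (7 ^ M * β ^ H)
        ≡⟨ regroup′ (2 ^ M) (N ^ E) (7 ^ M) (β ^ H) ⟩
      7 ^ M * (N ^ E * β ^ H) * 2 ^ M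
        ≡⟨ cong (λ y → 7 ^ M * y * 2 ^ M) ([x^a*y^b]^c N β k m (4 * n)) ⟨
      7 ^ M * (N ^ k * β ^ m) ^ (4 * n) * 2 ^ M ∎)
      where
      open ≤-Reasoning
      regroup : ∀ a b c d → a * b * c * d ≡ a * (c * d * b)
      regroup = solve-∀
      regroup′ : ∀ a b c d → a * b * (c * d) ≡ c * (b * d) * a
      regroup′ = solve-∀

    binomialTail≤[7/8]^M : binomialTail n k ^ (4 * n) * 8 ^ M ≤ 7 ^ M * (2 ^ n) ^ (4 * n)
    binomialTail≤[7/8]^M = cross-≤-trans {a = binomialTail n k ^ (4 * n)} {8 ^ M} {7 ^ M} {(2 ^ n) ^ (4 * n)}
      ((N ^ k * β ^ m) ^ (4 * n)) {{P≢0}}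
      (^-monoˡ-≤-* (4 * n) (binomialTail-split u k m)) chernoffRatio^4n≤[7/8]^M
      where
      P≢0 : NonZero ((N ^ k * β ^ m) ^ (4 * n))
      P≢0 = m^n≢0 _ (4 * n) {{m*n≢0 _ _ {{m^n≢0 N k {{N≢0}}}} {{m^n≢0 β m}}}}

  binomialTail-bound : ∀ {n k} → 2 * k < n →
    binomialTail n k ^ (4 * n) * 8 ^ ((n ∸ 2 * k) ^ 2) ≤ 7 ^ ((n ∸ 2 * k) ^ 2) * (2 ^ n) ^ (4 * n)
  binomialTail-bound {n} {k} 2k<n with n ∸ 2 * k | m+[n∸m]≡n (<⇒≤ 2k<n) | m<n⇒0<n∸m 2k<n
  ... | m | refl | 0<m = subst (λ M → binomialTail n k ^ (4 * n) * 8 ^ M ≤ 7 ^ M * (2 ^ n) ^ (4 * n))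
    (cong (m *_) (sym (*-identityʳ m))) (TailBound.binomialTail≤[7/8]^M q k m {{q≢0}} 2k≤qm qm≤n)
    where
    instance
      m≢0 : NonZero m
      m≢0 = >-nonZero 0<m
    q = n / m
    q≢0 : NonZero q
    q≢0 = >-nonZero (m≥n⇒m/n>0 (m≤n+m m (2 * k)))
    qm≤n : q * m ≤ n
    qm≤n = m/n*n≤m n m
    n<qm+m : n < q * m + m
    n<qm+m = begin-strict
      n               ≡⟨ m≡m%n+[m/n]*n n m ⟩
      n % m + q * m   <⟨ +-monoˡ-< (q * m) (m%n<n n m) ⟩
      m + q * m       ≡⟨ +-comm m (q * m) ⟩
      q * m + m       ∎
      where open ≤-Reasoning
    2k≤qm : 2 * k ≤ q * m
    2k≤qm = <⇒≤ (+-cancelʳ-< m (2 * k) (q * m) n<qm+m)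

module Counting where

  open BinomialTail using (binomialTail)
  open import Data.Bool using (Bool; true; false; if_then_else_; not; T)
  open import Data.Bool.Properties using () renaming (_≟_ to _≟B_)
  open import Data.Nat using (ℕ; zero; suc; _+_; _*_; _∸_; _^_; _≤_; _<_; z≤n; s≤s; _⊔_; _≟_)
  open import Data.Nat.Properties
  open import Data.List using (List; []; _∷_; _++_; map; concatMap; length; foldr; take; drop)
  open import Data.List.Properties using (length-map; length-++; length-++-sucʳ; take++drop≡id)
  open import Data.List.Relation.Unary.All as All using (All; []; _∷_)
  open import Data.List.Relation.Unary.All.Properties using (concat⁺; map⁺; ++⁺; filter⁺)
  open import Data.List.Relation.Unary.Any using (here; there)
  open import Data.List.Membership.Propositional using (_∈_)
  open import Data.List.Membership.Propositional.Properties using (∈-map⁺; ∈-filter⁺; ∈-++⁺ˡ)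
  open import Data.List.Relation.Binary.Sublist.DecPropositional _≟B_ using (_⊆_; _⊆?_; _∷_; _∷ʳ_; minimum)
  open import Function using (_∘_)
  open import Relation.Nullary using (Dec; does; yes; no; contradiction)
  open import Relation.Binary.PropositionalEquality

  count : {A : Set} → (A → Bool) → List A → ℕ
  count P []       = 0
  count P (x ∷ xs) = if P x then suc (count P xs) else count P xs

  module _ {A : Set} where

    count-++ : ∀ (P : A → Bool) xs ys → count P (xs ++ ys) ≡ count P xs + count P ys
    count-++ P []       ys = refl
    count-++ P (x ∷ xs) ys with P x
    ... | true  = cong suc (count-++ P xs ys)
    ... | false = count-++ P xs ys

    count-map : ∀ {B : Set} (P : B → Bool) (f : A → B) xs → count P (map f xs) ≡ count (P ∘ f) xs
    count-map P f []       = refl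
    count-map P f (x ∷ xs) with P (f x)
    ... | true  = cong suc (count-map P f xs)
    ... | false = count-map P f xs

    count-mono : ∀ {P Q : A → Bool} → (∀ x → T (P x) → T (Q x)) → ∀ xs → count P xs ≤ count Q xs
    count-mono         P⇒Q []       = z≤n
    count-mono {P} {Q} P⇒Q (x ∷ xs) with P x | Q x | P⇒Q x
    ... | true  | true  | _   = s≤s (count-mono P⇒Q xs)
    ... | true  | false | p⇒q = contradiction (p⇒q _) λ ()
    ... | false | true  | _   = m≤n⇒m≤1+n (count-mono P⇒Q xs)
    ... | false | false | _   = count-mono P⇒Q xs

    count≤length : ∀ (P : A → Bool) xs → count P xs ≤ length xs
    count≤length P []       = z≤n
    count≤length P (x ∷ xs) with P x
    ... | true  = s≤s (count≤length P xs)
    ... | false = m≤n⇒m≤1+n (count≤length P xs)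

    count-none : ∀ {P : A → Bool} → (∀ x → P x ≡ false) → ∀ xs → count P xs ≡ 0
    count-none never []       = refl
    count-none never (x ∷ xs) rewrite never x = count-none never xs

    count+count-not : ∀ (P : A → Bool) xs → count P xs + count (not ∘ P) xs ≡ length xs
    count+count-not P []       = refl
    count+count-not P (x ∷ xs) with P x
    ... | true  = cong suc (count+count-not P xs)
    ... | false = trans (+-suc _ _) (cong suc (count+count-not P xs))

  count-bitStrings-suc : ∀ (P : List Bool → Bool) n →
    count P (bitStrings (suc n)) ≡ count (P ∘ (true ∷_)) (bitStrings n) + count (P ∘ (false ∷_)) (bitStrings n)
  count-bitStrings-suc P n = go (bitStrings n)
    where
    go : ∀ ss → count P (concatMap (λ s → (true ∷ s) ∷ (false ∷ s) ∷ []) ss)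
                ≡ count (P ∘ (true ∷_)) ss + count (P ∘ (false ∷_)) ss
    go []       = refl
    go (s ∷ ss) with P (true ∷ s) | P (false ∷ s)
    ... | true  | true  = cong suc (trans (cong suc (go ss)) (sym (+-suc _ _)))
    ... | true  | false = cong suc (go ss)
    ... | false | true  = trans (cong suc (go ss)) (sym (+-suc _ _))
    ... | false | false = go ss

  avoids : List Bool → List Bool → Bool
  avoids z y = not (does (z ⊆? y))

  T-not-does-antimono : ∀ {A B : Set} (a? : Dec A) (b? : Dec B) → (A → B) → T (not (does b?)) → T (not (does a?))
  T-not-does-antimono (yes a) (yes _) f = λ ()
  T-not-does-antimono (yes a) (no ¬b) f = λ _ → contradiction (f a) ¬b
  T-not-does-antimono (no _)  _       f = _

  count-avoids≤binomialTail : ∀ n z → count (avoids z) (bitStrings n) ≤ binomialTail n (length z)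
  count-avoids≤binomialTail n       []      = ≤-reflexive (count-none contains-[] (bitStrings n))
    where
    contains-[] : ∀ y → avoids [] y ≡ false
    contains-[] y with [] ⊆? y
    ... | yes _   = refl
    ... | no []⊈y = contradiction (minimum y) []⊈y
  count-avoids≤binomialTail zero    (b ∷ z) = count≤length (avoids (b ∷ z)) (bitStrings zero)
  count-avoids≤binomialTail (suc n) (b ∷ z) = begin
    count (avoids (b ∷ z)) (bitStrings (suc n))
      ≡⟨ count-bitStrings-suc (avoids (b ∷ z)) n ⟩
    count (avoids (b ∷ z) ∘ (true ∷_)) (bitStrings n) + count (avoids (b ∷ z) ∘ (false ∷_)) (bitStrings n)
      ≤⟨ by-first-bit b ⟩
    binomialTail n (length z) + binomialTail n (suc (length z)) ∎
    where
    open ≤-Reasoning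
    matching : ∀ c → count (avoids (c ∷ z) ∘ (c ∷_)) (bitStrings n) ≤ binomialTail n (length z)
    matching c = ≤-trans
      (count-mono (λ s → T-not-does-antimono (z ⊆? s) ((c ∷ z) ⊆? (c ∷ s)) (refl ∷_)) (bitStrings n))
      (count-avoids≤binomialTail n z)
    skipping : ∀ c d → count (avoids (c ∷ z) ∘ (d ∷_)) (bitStrings n) ≤ binomialTail n (suc (length z))
    skipping c d = ≤-trans
      (count-mono (λ s → T-not-does-antimono ((c ∷ z) ⊆? s) ((c ∷ z) ⊆? (d ∷ s)) (d ∷ʳ_)) (bitStrings n))
      (count-avoids≤binomialTail n (c ∷ z))
    by-first-bit : ∀ c →
      count (avoids (c ∷ z) ∘ (true ∷_)) (bitStrings n) + count (avoids (c ∷ z) ∘ (false ∷_)) (bitStrings n)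
        ≤ binomialTail n (length z) + binomialTail n (suc (length z))
    by-first-bit true  = +-mono-≤ (matching true) (skipping true false)
    by-first-bit false = ≤-trans (≤-reflexive (+-comm (count (avoids (false ∷ z) ∘ (true ∷_)) (bitStrings n)) _))
      (+-mono-≤ (matching false) (skipping false true))

  foldr-⊔-lub : ∀ {k} {xs : List ℕ} → All (_≤ k) xs → foldr _⊔_ 0 xs ≤ k
  foldr-⊔-lub []       = z≤n
  foldr-⊔-lub (h ∷ hs) = ⊔-lub h (foldr-⊔-lub hs)

  ∈⇒≤foldr-⊔ : ∀ {x} {xs : List ℕ} → x ∈ xs → x ≤ foldr _⊔_ 0 xs
  ∈⇒≤foldr-⊔ {xs = y ∷ _} (here refl) = m≤m⊔n y _
  ∈⇒≤foldr-⊔ {xs = y ∷ _} (there x∈)  = ≤-trans (∈⇒≤foldr-⊔ x∈) (m≤n⊔m y _)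

  subseqs-length : ∀ (z : List Bool) → All (λ s → length s ≤ length z) (subseqs z)
  subseqs-length []      = z≤n ∷ []
  subseqs-length (x ∷ z) = ++⁺ (map⁺ (All.map s≤s (subseqs-length z))) (All.map m≤n⇒m≤1+n (subseqs-length z))

  ∈-subseqs : ∀ (z : List Bool) → z ∈ subseqs z
  ∈-subseqs []      = here refl
  ∈-subseqs (x ∷ z) = ∈-++⁺ˡ (∈-map⁺ (x ∷_) (∈-subseqs z))

  LCS-⊆ : ∀ {z y} → z ⊆ y → LCS z y ≡ length z
  LCS-⊆ {z} {y} z⊆y = ≤-antisym
    (foldr-⊔-lub (map⁺ (filter⁺ (_⊆? y) (subseqs-length z))))
    (∈⇒≤foldr-⊔ (∈-map⁺ length (∈-filter⁺ (_⊆? y) (∈-subseqs z) z⊆y)))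

  All-concatMap : ∀ {A B : Set} {P : A → Set} {Q : B → Set} (f : A → List B) →
    (∀ {x} → P x → All Q (f x)) → ∀ {xs} → All P xs → All Q (concatMap f xs)
  All-concatMap f Pf ps = concat⁺ (map⁺ (All.map Pf ps))

  bitStrings-length : ∀ m → All (λ s → length s ≡ m) (bitStrings m)
  bitStrings-length zero    = refl ∷ []
  bitStrings-length (suc m) = All-concatMap _ (λ eq → cong suc eq ∷ cong suc eq ∷ []) (bitStrings-length m)

  insSeqsFrom-length : ∀ f j k → All (λ ins → length ins ≡ f) (insSeqsFrom f j k)
  insSeqsFrom-length zero    j k = refl ∷ []
  insSeqsFrom-length (suc f) j k =
    All-concatMap _ (λ |rest|≡f → ++⁺ (extended |rest|≡f) (++⁺ (extended |rest|≡f) []))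
      (insSeqsFrom-length f (suc j) k)
    where
    extended : ∀ {v rest} → length rest ≡ f →
      All (λ ins → length ins ≡ suc f) (map (λ t → (v , t) ∷ rest) (range2 j))
    extended |rest|≡f = map⁺ (All.universal (λ _ → cong suc |rest|≡f) (range2 j))

  insertAt-length : ∀ {A : Set} p (x : A) xs → length (insertAt p x xs) ≡ suc (length xs)
  insertAt-length p x xs =
    trans (length-++-sucʳ (take (p ∸ 1) xs) x (drop (p ∸ 1) xs)) (cong (suc ∘ length) (take++drop≡id (p ∸ 1) xs))

  insertAll-length : ∀ ins z → length (insertAll ins z) ≡ length ins + length z
  insertAll-length []             z = refl
  insertAll-length ((v , t) ∷ vt) z =
    trans (insertAll-length vt (insertAt t v z)) (trans (cong (length vt +_) (insertAt-length t v z)) (+-suc _ _))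

  bitDropOutcomes-length : ∀ {k} → 2 ≤ k → All (λ z → length z ≡ k) (bitDropOutcomes k)
  bitDropOutcomes-length {k} 2≤k = All-concatMap (λ v₁₂ → map (λ ins → insertAll ins v₁₂) (insSeqs k))
    (λ {v₁₂} |v₁₂|≡2 → map⁺ (All.map (λ {ins} |ins|≡k-2 →
       trans (insertAll-length ins v₁₂) (trans (cong₂ _+_ |ins|≡k-2 |v₁₂|≡2) (m∸n+n≡m 2≤k)))
      (insSeqsFrom-length (k ∸ 2) 3 k)))
    (bitStrings-length 2)

  -- range2 (3 + j) starts with 2, so insSeqsFrom is a cons as soon as its recursive call is.
  insSeqsFrom-nonempty : ∀ f j k → 0 < length (insSeqsFrom f (3 + j) k)
  insSeqsFrom-nonempty zero    j k = s≤s z≤n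
  insSeqsFrom-nonempty (suc f) j k with insSeqsFrom f (4 + j) k | insSeqsFrom-nonempty f (suc j) k
  ... | _ ∷ _ | _ = s≤s z≤n

  bitDropOutcomes-nonempty : ∀ k → 0 < length (bitDropOutcomes k)
  bitDropOutcomes-nonempty k with insSeqs k | insSeqsFrom-nonempty (k ∸ 2) 0 k
  ... | _ ∷ _ | _ = s≤s z≤n

  -- probLCSfull n k is, by definition, Prob (pairs n (bitDropOutcomes k)) (lcsIs k).
  pairs : ℕ → List (List Bool) → List (List Bool × List Bool)
  pairs n zs = concatMap (λ z → map (λ y → z , y) (bitStrings n)) zs

  lcsIs : ℕ → List Bool × List Bool → Bool
  lcsIs k (z , y) = does (LCS z y ≟ k)

  length-concatMap-const : ∀ {A B : Set} (f : A → List B) {c} → (∀ x → length (f x) ≡ c) →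
    ∀ xs → length (concatMap f xs) ≡ length xs * c
  length-concatMap-const f |f|≡c []       = refl
  length-concatMap-const f |f|≡c (x ∷ xs) =
    trans (length-++ (f x)) (cong₂ _+_ (|f|≡c x) (length-concatMap-const f |f|≡c xs))

  length-bitStrings : ∀ n → length (bitStrings n) ≡ 2 ^ n
  length-bitStrings zero    = refl
  length-bitStrings (suc n) = begin
    length (bitStrings (suc n)) ≡⟨ length-concatMap-const _ (λ _ → refl) (bitStrings n) ⟩
    length (bitStrings n) * 2   ≡⟨ cong (_* 2) (length-bitStrings n) ⟩
    2 ^ n * 2                   ≡⟨ *-comm (2 ^ n) 2 ⟩
    2 ^ suc n                   ∎
    where open ≡-Reasoning

  length-pairs : ∀ n zs → length (pairs n zs) ≡ length zs * 2 ^ n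
  length-pairs n = length-concatMap-const _ (λ z → trans (length-map _ (bitStrings n)) (length-bitStrings n))

  count-failures≤ : ∀ n k zs → All (λ z → length z ≡ k) zs →
    count (not ∘ lcsIs k) (pairs n zs) ≤ length zs * binomialTail n k
  count-failures≤ n k []       []              = z≤n
  count-failures≤ n k (z ∷ zs) (|z|≡k ∷ |zs|≡k) = begin
    count (not ∘ lcsIs k) (map (z ,_) (bitStrings n) ++ pairs n zs)
      ≡⟨ count-++ (not ∘ lcsIs k) (map (z ,_) (bitStrings n)) (pairs n zs) ⟩
    count (not ∘ lcsIs k) (map (z ,_) (bitStrings n)) + count (not ∘ lcsIs k) (pairs n zs)
      ≡⟨ cong (_+ _) (count-map (not ∘ lcsIs k) (z ,_) (bitStrings n)) ⟩
    count (λ y → not (lcsIs k (z , y))) (bitStrings n) + count (not ∘ lcsIs k) (pairs n zs)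
      ≤⟨ +-mono-≤ (count-mono failure⇒avoids (bitStrings n)) (count-failures≤ n k zs |zs|≡k) ⟩
    count (avoids z) (bitStrings n) + length zs * binomialTail n k
      ≤⟨ +-monoˡ-≤ _ (subst (λ l → count (avoids z) (bitStrings n) ≤ binomialTail n l) |z|≡k
                        (count-avoids≤binomialTail n z)) ⟩
    binomialTail n k + length zs * binomialTail n k ∎
    where
    open ≤-Reasoning
    failure⇒avoids : ∀ y → T (not (lcsIs k (z , y))) → T (avoids z y)
    failure⇒avoids y = T-not-does-antimono (z ⊆? y) (LCS z y ≟ k) (λ z⊆y → trans (LCS-⊆ z⊆y) |z|≡k)

module Rationals where

  open BinomialTail using (binomialTail)
  open Counting using (count; count+count-not; pairs; lcsIs; length-pairs; count-failures≤)
  open import Data.Bool using (Bool; true; false; if_then_else_; not)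
  open import Data.Nat as ℕ using (ℕ; zero; suc)
  import Data.Nat.Properties as ℕ
  open import Data.Nat.Coprimality using (1-coprimeTo) renaming (sym to coprime-sym)
  open import Data.Integer as ℤ using (ℤ; +≤+)
  import Data.Integer.Properties as ℤ
  open import Data.Integer.Tactic.RingSolver as ℤ-Solver using ()
  open import Data.Rational
  open import Data.Rational.Properties
  open import Data.Rational.Solver using (module +-*-Solver)
  import Data.Rational.Unnormalised as ℚᵘ
  import Data.Rational.Unnormalised.Properties as ℚᵘ
  open import Data.List using ([]; _∷_; map; foldr; length)
  open import Data.List.Properties using (length-map)
  open import Data.List.Relation.Unary.All using (All)
  open import Function using (_∘_)
  open import Relation.Binary.PropositionalEquality

  fromℕ : ℕ → ℚ
  fromℕ n = mkℚ (ℤ.+ n) 0 (coprime-sym (1-coprimeTo n))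

  fromℕ-suc : ∀ n → fromℕ (suc n) ≡ 1ℚ + fromℕ n
  fromℕ-suc n =
    toℚᵘ-injective (ℚᵘ.≃-trans (ℚᵘ.*≡* (cross (ℤ.+ n))) (ℚᵘ.≃-sym (toℚᵘ-homo-+ 1ℚ (fromℕ n))))
    where
    cross : ∀ (x : ℤ) → (ℤ.1ℤ ℤ.+ x) ℤ.* ℤ.1ℤ ≡ (ℤ.1ℤ ℤ.* ℤ.1ℤ ℤ.+ x ℤ.* ℤ.1ℤ) ℤ.* ℤ.1ℤ
    cross = ℤ-Solver.solve-∀

  fromℕ-+ : ∀ m n → fromℕ (m ℕ.+ n) ≡ fromℕ m + fromℕ n
  fromℕ-+ zero    n = sym (+-identityˡ (fromℕ n))
  fromℕ-+ (suc m) n = begin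
    fromℕ (suc (m ℕ.+ n))     ≡⟨ fromℕ-suc (m ℕ.+ n) ⟩
    1ℚ + fromℕ (m ℕ.+ n)      ≡⟨ cong (1ℚ +_) (fromℕ-+ m n) ⟩
    1ℚ + (fromℕ m + fromℕ n)  ≡⟨ +-assoc 1ℚ (fromℕ m) (fromℕ n) ⟨
    1ℚ + fromℕ m + fromℕ n    ≡⟨ cong (_+ fromℕ n) (fromℕ-suc m) ⟨
    fromℕ (suc m) + fromℕ n   ∎
    where open ≡-Reasoning

  fromℕ-* : ∀ m n → fromℕ (m ℕ.* n) ≡ fromℕ m * fromℕ n
  fromℕ-* zero    n = sym (*-zeroˡ (fromℕ n))
  fromℕ-* (suc m) n = begin
    fromℕ (n ℕ.+ m ℕ.* n)            ≡⟨ fromℕ-+ n (m ℕ.* n) ⟩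
    fromℕ n + fromℕ (m ℕ.* n)        ≡⟨ cong (fromℕ n +_) (fromℕ-* m n) ⟩
    fromℕ n + fromℕ m * fromℕ n      ≡⟨ cong (_+ fromℕ m * fromℕ n) (*-identityˡ (fromℕ n)) ⟨
    1ℚ * fromℕ n + fromℕ m * fromℕ n ≡⟨ *-distribʳ-+ (fromℕ n) 1ℚ (fromℕ m) ⟨
    (1ℚ + fromℕ m) * fromℕ n         ≡⟨ cong (_* fromℕ n) (fromℕ-suc m) ⟨
    fromℕ (suc m) * fromℕ n          ∎
    where open ≡-Reasoning

  fromℕ-^ : ∀ m e → fromℕ (m ℕ.^ e) ≡ fromℕ m ^ℚ e
  fromℕ-^ m zero    = refl
  fromℕ-^ m (suc e) = trans (fromℕ-* m (m ℕ.^ e)) (cong (fromℕ m *_) (fromℕ-^ m e))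

  fromℕ-mono-≤ : ∀ {m n} → m ℕ.≤ n → fromℕ m ≤ fromℕ n
  fromℕ-mono-≤ {m} {n} m≤n =
    *≤* (subst₂ ℤ._≤_ (sym (ℤ.*-identityʳ (ℤ.+ m))) (sym (ℤ.*-identityʳ (ℤ.+ n))) (+≤+ m≤n))

  fromℕ-nonNeg : ∀ n → 0ℚ ≤ fromℕ n
  fromℕ-nonNeg n = fromℕ-mono-≤ ℕ.z≤n

  fromℕ-pos : ∀ n .{{_ : ℕ.NonZero n}} → Positive (fromℕ n)
  fromℕ-pos (suc n) = _

  ^ℚ-distribʳ-* : ∀ p q e → (p * q) ^ℚ e ≡ p ^ℚ e * q ^ℚ e
  ^ℚ-distribʳ-* p q zero    = sym (*-identityˡ 1ℚ)
  ^ℚ-distribʳ-* p q (suc e) = begin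
    p * q * (p * q) ^ℚ e         ≡⟨ cong (p * q *_) (^ℚ-distribʳ-* p q e) ⟩
    p * q * (p ^ℚ e * q ^ℚ e)    ≡⟨ interchange p q (p ^ℚ e) (q ^ℚ e) ⟩
    p * p ^ℚ e * (q * q ^ℚ e)    ∎
    where
    open ≡-Reasoning
    open +-*-Solver
    interchange : ∀ a b c d → a * b * (c * d) ≡ a * c * (b * d)
    interchange = solve 4 (λ a b c d → a :* b :* (c :* d) := a :* c :* (b :* d)) refl

  ^ℚ-nonNeg : ∀ {p} e → 0ℚ ≤ p → 0ℚ ≤ p ^ℚ e
  ^ℚ-nonNeg     zero    0≤p = fromℕ-nonNeg 1
  ^ℚ-nonNeg {p} (suc e) 0≤p =
    subst (_≤ p * p ^ℚ e) (*-zeroʳ p) (*-monoˡ-≤-nonNeg p {{nonNegative 0≤p}} (^ℚ-nonNeg e 0≤p))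

  ^ℚ-monoˡ-≤ : ∀ {p q} e → 0ℚ ≤ p → p ≤ q → p ^ℚ e ≤ q ^ℚ e
  ^ℚ-monoˡ-≤         zero    0≤p p≤q = ≤-refl
  ^ℚ-monoˡ-≤ {p} {q} (suc e) 0≤p p≤q = ≤-trans
    (*-monoʳ-≤-nonNeg (p ^ℚ e) {{nonNegative (^ℚ-nonNeg e 0≤p)}} p≤q)
    (*-monoˡ-≤-nonNeg q {{nonNegative (≤-trans 0≤p p≤q)}} (^ℚ-monoˡ-≤ e 0≤p p≤q))

  module _ {Ω : Set} (E : Ω → Bool) where

    sum-indicators : ∀ ωs → foldr _+_ 0ℚ (map (λ ω → if E ω then 1ℚ else 0ℚ) ωs) ≡ fromℕ (count E ωs)
    sum-indicators []       = refl
    sum-indicators (ω ∷ ωs) with E ω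
    ... | true  = trans (cong (1ℚ +_) (sum-indicators ωs)) (sym (fromℕ-suc (count E ωs)))
    ... | false = trans (+-identityˡ _) (sum-indicators ωs)

    [1-Prob]*length : ∀ ωs .{{_ : ℕ.NonZero (length ωs)}} →
      (1ℚ - Prob ωs E) * fromℕ (length ωs) ≡ fromℕ (count (not ∘ E) ωs)
    [1-Prob]*length ωs@(ω ∷ ωs′) = begin
      (1ℚ - S * w) * L            ≡⟨ distrib S w L ⟩
      L - S * (L * w)             ≡⟨ cong (λ x → L - S * x) L*w≡1 ⟩
      L - S * 1ℚ                  ≡⟨ cong (λ x → L - x) (*-identityʳ S) ⟩
      L - S                       ≡⟨ cong₂ _-_ L≡c+f (sum-indicators ωs) ⟩
      fromℕ c + fromℕ f - fromℕ c ≡⟨ cancel (fromℕ c) (fromℕ f) ⟩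
      fromℕ f                     ∎
      where
      open ≡-Reasoning
      open +-*-Solver
      g = λ ω → if E ω then 1ℚ else 0ℚ
      S = foldr _+_ 0ℚ (map g ωs)
      w = ℤ.+ 1 / suc (length (map g ωs′))
      L = fromℕ (length ωs)
      c = count E ωs
      f = count (not ∘ E) ωs
      L≡c+f : L ≡ fromℕ c + fromℕ f
      L≡c+f = trans (cong fromℕ (sym (count+count-not E ωs))) (fromℕ-+ c f)
      L*w≡1 : L * w ≡ 1ℚ
      L*w≡1 = begin
        L * (ℤ.+ 1 / suc (length (map g ωs′))) ≡⟨ cong (λ l → L * (ℤ.+ 1 / suc l)) (length-map g ωs′) ⟩
        L * (ℤ.+ 1 / suc (length ωs′))         ≡⟨ cong (L *_) (↥p/↧p≡p (1/ L)) ⟩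
        L * 1/ L                               ≡⟨ *-inverseʳ L ⟩
        1ℚ                                     ∎
      distrib : ∀ S w L → (1ℚ - S * w) * L ≡ L - S * (L * w)
      distrib = solve 3 (λ S w L → (con 1ℚ :- S :* w) :* L := L :- S :* (L :* w)) refl
      cancel : ∀ a b → a + b - a ≡ b
      cancel = solve 2 (λ a b → a :+ b :- a := b) refl

  ^ℚ-bound-from-ℕ : ∀ {x r T B c d} e M .{{_ : ℕ.NonZero T}} .{{_ : ℕ.NonZero d}} →
    r * fromℕ d ≡ fromℕ c → 0ℚ ≤ x → x * fromℕ T ≤ fromℕ B →
    B ℕ.^ e ℕ.* d ℕ.^ M ℕ.≤ c ℕ.^ M ℕ.* T ℕ.^ e → x ^ℚ e ≤ r ^ℚ M
  ^ℚ-bound-from-ℕ {x} {r} {T} {B} {c} {d} e M r*d≡c 0≤x xT≤B Bd≤cT =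
    *-cancelʳ-≤-pos (fromℕ T ^ℚ e * fromℕ d ^ℚ M) {{denominator-pos}} (begin
      x ^ℚ e * (fromℕ T ^ℚ e * fromℕ d ^ℚ M) ≡⟨ *-assoc (x ^ℚ e) _ _ ⟨
      x ^ℚ e * fromℕ T ^ℚ e * fromℕ d ^ℚ M   ≡⟨ cong (_* fromℕ d ^ℚ M) (^ℚ-distribʳ-* x (fromℕ T) e) ⟨
      (x * fromℕ T) ^ℚ e * fromℕ d ^ℚ M      ≤⟨ *-monoʳ-≤-nonNeg (fromℕ d ^ℚ M) {{dᴹ≥0}} (^ℚ-monoˡ-≤ e 0≤xT xT≤B) ⟩
      fromℕ B ^ℚ e * fromℕ d ^ℚ M            ≡⟨ cast-* B e d M ⟨
      fromℕ (B ℕ.^ e ℕ.* d ℕ.^ M)            ≤⟨ fromℕ-mono-≤ Bd≤cT ⟩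
      fromℕ (c ℕ.^ M ℕ.* T ℕ.^ e)            ≡⟨ cast-* c M T e ⟩
      fromℕ c ^ℚ M * fromℕ T ^ℚ e            ≡⟨ cong (λ y → y ^ℚ M * fromℕ T ^ℚ e) r*d≡c ⟨
      (r * fromℕ d) ^ℚ M * fromℕ T ^ℚ e      ≡⟨ cong (_* fromℕ T ^ℚ e) (^ℚ-distribʳ-* r (fromℕ d) M) ⟩
      r ^ℚ M * fromℕ d ^ℚ M * fromℕ T ^ℚ e   ≡⟨ rearrange (r ^ℚ M) (fromℕ d ^ℚ M) (fromℕ T ^ℚ e) ⟩
      r ^ℚ M * (fromℕ T ^ℚ e * fromℕ d ^ℚ M) ∎)
    where
    open ≤-Reasoning
    open +-*-Solver
    cast-* : ∀ a i b j → fromℕ (a ℕ.^ i ℕ.* b ℕ.^ j) ≡ fromℕ a ^ℚ i * fromℕ b ^ℚ j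
    cast-* a i b j = trans (fromℕ-* (a ℕ.^ i) (b ℕ.^ j)) (cong₂ _*_ (fromℕ-^ a i) (fromℕ-^ b j))
    denominator-pos : Positive (fromℕ T ^ℚ e * fromℕ d ^ℚ M)
    denominator-pos = subst Positive (cast-* T e d M)
      (fromℕ-pos (T ℕ.^ e ℕ.* d ℕ.^ M) {{ℕ.m*n≢0 _ _ {{ℕ.m^n≢0 T e}} {{ℕ.m^n≢0 d M}}}})
    dᴹ≥0 : NonNegative (fromℕ d ^ℚ M)
    dᴹ≥0 = nonNegative (^ℚ-nonNeg M (fromℕ-nonNeg d))
    0≤xT : 0ℚ ≤ x * fromℕ T
    0≤xT = subst (_≤ x * fromℕ T) (*-zeroˡ (fromℕ T))
      (*-monoʳ-≤-nonNeg (fromℕ T) {{nonNegative (fromℕ-nonNeg T)}} 0≤x)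
    rearrange : ∀ a b c → a * b * c ≡ a * (c * b)
    rearrange = solve 3 (λ a b c → a :* b :* c := a :* (c :* b)) refl

  failureRate-bound : ∀ n k zs .{{_ : ℕ.NonZero (length zs)}} → All (λ z → length z ≡ k) zs →
    let x = 1ℚ - Prob (pairs n zs) (lcsIs k) in
    (0ℚ ≤ x) × (x * fromℕ (2 ℕ.^ n) ≤ fromℕ (binomialTail n k))
  failureRate-bound n k zs |zs|≡k = 0≤x , x2ⁿ≤B
    where
    x = 1ℚ - Prob (pairs n zs) (lcsIs k)
    Z = length zs
    fails = count (not ∘ lcsIs k) (pairs n zs)
    instance
      2ⁿ≢0 : ℕ.NonZero (2 ℕ.^ n)
      2ⁿ≢0 = ℕ.m^n≢0 2 n
      Z2ⁿ≢0 : ℕ.NonZero (Z ℕ.* 2 ℕ.^ n)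
      Z2ⁿ≢0 = ℕ.m*n≢0 Z (2 ℕ.^ n)
      |pairs|≢0 : ℕ.NonZero (length (pairs n zs))
      |pairs|≢0 = subst ℕ.NonZero (sym (length-pairs n zs)) Z2ⁿ≢0
    xZ2ⁿ≡fails : x * fromℕ (Z ℕ.* 2 ℕ.^ n) ≡ fromℕ fails
    xZ2ⁿ≡fails =
      trans (cong (λ l → x * fromℕ l) (sym (length-pairs n zs))) ([1-Prob]*length (lcsIs k) (pairs n zs))
    0≤x : 0ℚ ≤ x
    0≤x = *-cancelʳ-≤-pos (fromℕ (Z ℕ.* 2 ℕ.^ n)) {{fromℕ-pos (Z ℕ.* 2 ℕ.^ n)}}
      (subst₂ _≤_ (sym (*-zeroˡ (fromℕ (Z ℕ.* 2 ℕ.^ n)))) (sym xZ2ⁿ≡fails) (fromℕ-nonNeg fails))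
    x2ⁿ≤B : x * fromℕ (2 ℕ.^ n) ≤ fromℕ (binomialTail n k)
    x2ⁿ≤B = *-cancelˡ-≤-pos (fromℕ Z) {{fromℕ-pos Z}} (begin
      fromℕ Z * (x * fromℕ (2 ℕ.^ n))    ≡⟨ swap (fromℕ Z) x (fromℕ (2 ℕ.^ n)) ⟩
      x * (fromℕ Z * fromℕ (2 ℕ.^ n))    ≡⟨ cong (x *_) (fromℕ-* Z (2 ℕ.^ n)) ⟨
      x * fromℕ (Z ℕ.* 2 ℕ.^ n)          ≡⟨ xZ2ⁿ≡fails ⟩
      fromℕ fails                        ≤⟨ fromℕ-mono-≤ (count-failures≤ n k zs |zs|≡k) ⟩
      fromℕ (Z ℕ.* binomialTail n k)     ≡⟨ fromℕ-* Z (binomialTail n k) ⟩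
      fromℕ Z * fromℕ (binomialTail n k) ∎)
      where
      open ≤-Reasoning
      open +-*-Solver
      swap : ∀ a b c → a * (b * c) ≡ b * (a * c)
      swap = solve 3 (λ a b c → a :* (b :* c) := b :* (a :* c)) refl


open import Data.Nat using (ℕ; _≤_; _<_; _*_; _∸_; _^_)
open import Data.Rational using (ℚ; 0ℚ; 1ℚ; _-_) renaming (_<_ to _<ℚ_; _≤_ to _≤ℚ_)
open import Data.Product using (Σ; _×_)
open import Data.Integer using (+_)
open import Data.Rational using (_/_)
open import Data.Rational.Properties using (_<?_)
import Data.Nat as ℕ
import Data.Nat.Properties as ℕ
open import Relation.Nullary.Decidable using (toWitness)
open import Relation.Binary.PropositionalEquality using (refl)
open BinomialTail using (binomialTail-bound)
open Counting using (bitDropOutcomes-length; bitDropOutcomes-nonempty)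
open Rationals using (^ℚ-bound-from-ℕ; failureRate-bound)

lemma5p1 : Σ ℚ (λ r → (0ℚ <ℚ r) × (r <ℚ 1ℚ) ×
               ((n k : ℕ) → 2 ≤ k → 2 * k < n →
                 ((1ℚ - probLCSfull n k) ^ℚ (4 * n)) ≤ℚ (r ^ℚ ((n ∸ 2 * k) ^ 2))))
lemma5p1 = + 7 / 8 , toWitness {a? = 0ℚ <? + 7 / 8} _ , toWitness {a? = + 7 / 8 <? 1ℚ} _ ,
  λ n k 2≤k 2k<n →
    let 0≤x , x2ⁿ≤tail = failureRate-bound n k (bitDropOutcomes k) {{ℕ.>-nonZero (bitDropOutcomes-nonempty k)}}
                           (bitDropOutcomes-length 2≤k)
    in ^ℚ-bound-from-ℕ (4 * n) ((n ∸ 2 * k) ^ 2) {{ℕ.m^n≢0 2 n}} refl 0≤x x2ⁿ≤tail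
         (binomialTail-bound {k = k} 2k<n)
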